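{- Let $\Sigma$ be an alphabet of $n$ letters, let $\ell\notin\Sigma$, and let $\pi:\pi_1<_\pi\pi_2<_\pi\cdots<_\pi\pi_{n+1}$ be a total ordering of $\Sigma\cup\{\ell\}$ with $\pi_1\neq\ell$. Let $P_1,\dots,P_k$ be permutations of $\Sigma$, written $P_i=p_{i1}p_{i2}\cdots p_{in}$. For each $i$ define a sequence of letters $\beta_{i1},\beta_{i2},\dots,\beta_{iw_i}$ as follows: $\beta_{i1}=\pi_1$; for $j\ge 1$, if $\beta_{ij}=p_{ix}$ for some $x$ and $\beta_{ij}<_\pi\min_\pi\{p_{in},\ell\}$, set $\beta_{i(j+1)}=\min_\pi\{p_{i(x+1)},\dots,p_{in},\ell\}$; otherwise stop, and let $w_i=j$ be the index of the last term. Let $S_{ij}$ be the lineage taxon string of $\beta_{ij}$ in the line tree $T(P_i)$ under $\pi$. Then for each $i$, $$P_i=S_{i1}[1,|S_{i1}|-1]\,\beta_{i1}\,S_{i2}[1,|S_{i2}|-1]\,\beta_{i2}\cdots S_{i(w_i-1)}[1,|S_{i(w_i-1)}|-1]\,\beta_{i(w_i-1)}\,S'_{iw_i},$$ where $S'_{iw_i}=S_{iw_i}$ if $\beta_{iw_i}=\ell$ and $S'_{iw_i}=S_{iw_i}[1,|S_{iw_i}|-1]\,\beta_{iw_i}$ if $\beta_{iw_i}\neq\ell$; here $S[1,|S|-1]$ denotes the string obtained from $S$ by deleting its last letter, and juxtaposition denotes concatenation.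
   Context: For a permutation $P=p_1\cdots p_n$ of $\Sigma$, the line tree $T(P)$ is the rooted binary tree on leaf set $\Sigma\cup\{\ell\}$ with nodes $\Sigma\cup\{\ell,r,v_1,\dots,v_n\}$ and directed edges $(r,v_1)$, $(v_i,v_{i+1})$ and $(v_i,p_i)$ for $1\le i\le n-1$, and $(v_n,\ell)$, $(v_n,p_n)$; $r$ is the root (outdegree 1). Lineage taxon strings (LTSs): given a rooted binary tree $T$ whose leaves are labeled by a taxon set $X$ and a total ordering $\pi$ of $X$, for a node $u$ let $\min_\pi(u)$ be the $\pi$-smallest taxon at or below $u$. Label the root with the $\pi$-smallest taxon, and each non-root internal node $u$ with children $u',u''$ with the $\pi$-larger of $\min_\pi(u')$ and $\min_\pi(u'')$; then each taxon $f$ labels exactly one such node $w_f$, and $f$ lies below $w_f$. The LTS of $f$ is the string of labels of the nodes strictly between $w_f$ and $f$ on the directed path from $w_f$ to $f$, listed in order from $w_f$ toward $f$ (possibly empty). For example, for $T(edabc)$ under $a<b<c<d<e<\ell$ the LTSs of $a,b,c$ are $edb$, $c$, $\ell$ and those of $d,e,\ell$ are empty. -}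

module Defs where

open import Data.Nat using (ℕ; _<ᵇ_)
open import Data.Fin as Fin using (Fin)
open import Data.Maybe as Maybe using (Maybe; just; nothing; _<∣>_; fromMaybe)
open import Data.Maybe.Properties using (≡-dec)
open import Data.List using (List; []; _∷_; _++_; map; foldl; allFin)
open import Data.Bool using (Bool; true; false; if_then_else_)
open import Relation.Nullary using (does)
open import Relation.Binary.PropositionalEquality using (_≡_)
open import Relation.Binary.Definitions using (DecidableEquality)

-- The alphabet Σ is Fin n; the extended alphabet Σ ∪ {ℓ} is Maybe (Fin n),
-- with  just a  the letter a ∈ Σ  and  nothing  the extra letter ℓ ∉ Σ.
Letter : ℕ → Set
Letter n = Maybe (Fin n)

ℓ : ∀ {n} → Letter n
ℓ = nothing

_≟L_ : ∀ {n} → DecidableEquality (Letter n)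
_≟L_ = ≡-dec Fin._≟_

allLetters : ∀ n → List (Letter n)
allLetters n = ℓ ∷ map just (allFin n)

-- A rooted binary tree whose
-- root has outdegree 1 (as T(P)) is represented by the subtree hanging below
-- the root (the root r itself is implicit, "planted" above it).
data BTree (A : Set) : Set where
  leaf : A → BTree A
  node : BTree A → BTree A → BTree A

-- A total ordering π of Σ ∪ {ℓ} is given by an injective rank function
-- (x <π y  iff  rank x < rank y).
module Order {n : ℕ} (rank : Letter n → ℕ) where

  minπ₂ : Letter n → Letter n → Letter n
  minπ₂ a b = if rank b <ᵇ rank a then b else a

  maxπ₂ : Letter n → Letter n → Letter n
  maxπ₂ a b = if rank b <ᵇ rank a then a else b

  minπ : Letter n → List (Letter n) → Letter n
  minπ a as = foldl minπ₂ a as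

  π₁ : Letter n
  π₁ = minπ ℓ (map just (allFin n))

  minBelow : BTree (Letter n) → Letter n
  minBelow (leaf a)   = a
  minBelow (node l r) = minπ₂ (minBelow l) (minBelow r)

  label : BTree (Letter n) → Letter n
  label (leaf a)   = a
  label (node l r) = maxπ₂ (minBelow l) (minBelow r)

  pathTo : Letter n → BTree (Letter n) → Maybe (List (Letter n))
  pathTo f (leaf a)     = if does (a ≟L f) then just [] else nothing
  pathTo f t@(node l r) = Maybe.map (label t ∷_) (pathTo f l <∣> pathTo f r)

  -- labels of all internal nodes on the directed path from the root r
  -- (labelled with the π-smallest taxon) to the leaf f
  rootPath : Letter n → BTree (Letter n) → List (Letter n)
  rootPath f t = minBelow t ∷ fromMaybe [] (pathTo f t)

  afterLast : Letter n → List (Letter n) → List (Letter n)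
  afterLast f xs = go xs []
    where
    go : List (Letter n) → List (Letter n) → List (Letter n)
    go []       acc = acc
    go (x ∷ xs) acc = if does (x ≟L f) then go xs [] else go xs (acc ++ x ∷ [])

  -- LTS of taxon f in the planted tree (root r above t):
  -- labels of the nodes strictly between w_f and f.
  LTS : Letter n → BTree (Letter n) → List (Letter n)
  LTS f t = afterLast f (rootPath f t)

  -- subtree of T(P) rooted at v_i, for the suffix p_i ⋯ p_n:
  -- v_i → v_{i+1}, v_i → p_i, and v_n → ℓ, v_n → p_n.
  lineSub : List (Fin n) → BTree (Letter n)
  lineSub []       = leaf ℓ
  lineSub (p ∷ ps) = node (lineSub ps) (leaf (just p))

  -- T(P) is the planted tree r → v_1 with body lineSub P
  lineTree : List (Fin n) → BTree (Letter n)
  lineTree P = lineSub P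

  lastL : List (Fin n) → Letter n
  lastL []           = ℓ
  lastL (p ∷ [])     = just p
  lastL (p ∷ q ∷ ps) = lastL (q ∷ ps)

  -- betasFrom bound b ws: b is the current β_j; ws is the part of P still to be
  -- searched for b (b, if in Σ, occurs in ws).  When b = p_x is found, the
  -- remaining list is p_{x+1} ⋯ p_n.  bound = min_π{p_n, ℓ}.
  betasFrom : Letter n → Letter n → List (Fin n) → List (Letter n)
  betasFrom bound b []       = b ∷ []
  betasFrom bound b (w ∷ ws) =
    if does (just w ≟L b)
    then (if rank b <ᵇ rank bound
          then b ∷ betasFrom bound (minπ ℓ (map just ws)) ws
          else b ∷ [])
    else betasFrom bound b ws

  betas : List (Fin n) → List (Letter n)
  betas P = betasFrom (minπ₂ (lastL P) ℓ) π₁ P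

  dropLast : List (Letter n) → List (Letter n)
  dropLast []           = []
  dropLast (x ∷ [])     = []
  dropLast (x ∷ y ∷ xs) = x ∷ dropLast (y ∷ xs)

  decompose : List (Fin n) → List (Letter n) → List (Letter n)
  decompose P []           = []
  decompose P (b ∷ [])     =
    if does (b ≟L ℓ) then LTS b (lineTree P)
    else dropLast (LTS b (lineTree P)) ++ b ∷ []
  decompose P (b ∷ c ∷ bs) = dropLast (LTS b (lineTree P)) ++ b ∷ decompose P (c ∷ bs)

  rhs : List (Fin n) → List (Letter n)
  rhs P = decompose P (betas P)

{-# OPTIONS --safe #-}
module Submission where

-- Each spine node v_i of T(P) is labelled by the π-larger of p_i and the π-minimum of
-- p_{i+1} ⋯ p_n ℓ.  Invariant: the node directly above the subtree of a suffix w of P is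
-- labelled β = min_π(w ∪ {ℓ}).  If β = ℓ, every node along w is labelled by its own letter,
-- so LTS(ℓ) = w.  Otherwise w = A β C, the nodes of A are labelled by their letters, the
-- node of β by min_π(C ∪ {ℓ}), so LTS(β) = A · min_π(C ∪ {ℓ}); deleting its last letter
-- leaves A, and the node of β is the parent of C with the right label, so the recursion
-- continues with the next β.  It stops exactly when C is empty, i.e. β = p_n <π ℓ.

open import Defs
open import Data.Nat using (ℕ)
open import Data.Fin using (Fin)
open import Data.Maybe using (just)
open import Data.List using (List; map; allFin)
open import Data.List.Relation.Binary.Permutation.Propositional using (_↭_)
open import Relation.Binary.PropositionalEquality using (_≡_; _≢_)
open import Function.Definitions using (Injective)
open import Function using (id)

open import Data.Nat using (suc; _<ᵇ_; _≤_; _<_; s≤s)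
open import Data.Nat.Properties
  using (<ᵇ-reflects-<; ≮⇒≥; <-≤-trans; ≤-refl; ≤-trans; ≤-<-trans; <⇒≤; <-asym; <-irrefl; ≤-antisym; m≤n⇒m<n∨m≡n; m≤n+m)
open import Data.Maybe as Maybe using (nothing; fromMaybe; _<∣>_)
open import Data.Maybe.Properties using (just-injective)
open import Data.List using ([]; _∷_; _++_; length)
open import Data.List.Properties using (++-assoc; ++-identityʳ; map-++; length-++)
open import Data.List.Membership.Propositional using (_∈_; _∉_)
open import Data.List.Membership.Propositional.Properties using (∈-∃++; ∈-map⁺; ∈-map⁻; ∈-++⁺ˡ; ∈-++⁺ʳ; ∈-++⁻; ∈-allFin)
open import Data.List.Relation.Unary.Any using (here; there)
open import Data.List.Relation.Unary.All as All using (All; []; _∷_)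
open import Data.List.Relation.Unary.AllPairs using (_∷_)
open import Data.List.Relation.Unary.Unique.Propositional using (Unique)
open import Data.List.Relation.Unary.Unique.Propositional.Properties using (allFin⁺; Unique[x∷xs]⇒x∉xs)
open import Data.List.Relation.Binary.Permutation.Propositional using (↭-sym; ↭⇒↭ₛ)
open import Data.List.Relation.Binary.Permutation.Propositional.Properties using (∈-resp-↭)
import Data.List.Relation.Binary.Permutation.Setoid.Properties as PermutationSetoid
open import Data.Bool using (true; false; if_then_else_)
open import Data.Product using (Σ; ∃; _×_; _,_; proj₁; proj₂)
open import Data.Sum using (_⊎_; inj₁; inj₂)
open import Data.Empty using (⊥-elim)
open import Relation.Nullary using (does)
open import Relation.Nullary.Reflects using (ofʸ; ofⁿ)
open import Relation.Nullary.Decidable using (dec-true; dec-false)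
open import Relation.Binary.PropositionalEquality
  using (refl; sym; trans; cong; cong₂; subst; setoid; module ≡-Reasoning)

Unique-++⁻ʳ : ∀ {A : Set} (xs : List A) {ys} → Unique (xs ++ ys) → Unique ys
Unique-++⁻ʳ []       u       = u
Unique-++⁻ʳ (x ∷ xs) (_ ∷ u) = Unique-++⁻ʳ xs u

Unique[xs++y∷ys]⇒y∉xs : ∀ {A : Set} (xs : List A) {y ys} → Unique (xs ++ y ∷ ys) → y ∉ xs
Unique[xs++y∷ys]⇒y∉xs (x ∷ xs) (x∉ ∷ u) (here refl) = All.lookup x∉ (∈-++⁺ʳ xs (here refl)) refl
Unique[xs++y∷ys]⇒y∉xs (x ∷ xs) (_ ∷ u)  (there y∈) = Unique[xs++y∷ys]⇒y∉xs xs u y∈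

module LineTree {n : ℕ} (rank : Letter n → ℕ) where
  open Order rank
  open ≡-Reasoning

  _≤π_ : Letter n → Letter n → Set
  a ≤π b = rank a ≤ rank b

  _<π_ : Letter n → Letter n → Set
  a <π b = rank a < rank b

  scan : Letter n → List (Letter n) → List (Letter n) → List (Letter n)
  scan f []       acc = acc
  scan f (x ∷ xs) acc = if does (x ≟L f) then scan f xs [] else scan f xs (acc ++ x ∷ [])

  scan-unique : ∀ f (go : List (Letter n) → List (Letter n) → List (Letter n)) →
                (∀ acc → go [] acc ≡ acc) →
                (∀ x xs acc → go (x ∷ xs) acc ≡ (if does (x ≟L f) then go xs [] else go xs (acc ++ x ∷ []))) →
                ∀ xs acc → go xs acc ≡ scan f xs acc
  scan-unique f go go-[] go-∷ []       acc = go-[] acc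
  scan-unique f go go-[] go-∷ (x ∷ xs) acc with does (x ≟L f) | go-∷ x xs acc
  ... | true  | go≡ = trans go≡ (scan-unique f go go-[] go-∷ xs [])
  ... | false | go≡ = trans go≡ (scan-unique f go go-[] go-∷ xs (acc ++ x ∷ []))

  -- The helper of afterLast is local to its definition; abstracting the list and the
  -- accumulator turns it into a solvable instance of scan-unique.
  afterLast≡scan : ∀ f xs → afterLast f xs ≡ scan f xs []
  afterLast≡scan f xs with scan-unique f _ (λ _ → refl) (λ _ _ _ → refl) | xs | List.[] {A = Letter n}
  ... | unique | xs′ | acc = unique xs′ acc

  scan-∉ : ∀ {f} ys acc → f ∉ ys → scan f ys acc ≡ acc ++ ys
  scan-∉ []       acc f∉ = sym (++-identityʳ acc)
  scan-∉ {f} (y ∷ ys) acc f∉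
    rewrite dec-false (y ≟L f) (λ y≡f → f∉ (here (sym y≡f))) =
    trans (scan-∉ ys (acc ++ y ∷ []) (λ f∈ → f∉ (there f∈))) (++-assoc acc (y ∷ []) ys)

  scan-++-∷ : ∀ {f} xs ys acc → f ∉ ys → scan f (xs ++ f ∷ ys) acc ≡ ys
  scan-++-∷ {f} [] ys acc f∉ rewrite dec-true (f ≟L f) refl = scan-∉ ys [] f∉
  scan-++-∷ {f} (x ∷ xs) ys acc f∉ with does (x ≟L f)
  ... | true  = scan-++-∷ xs ys [] f∉
  ... | false = scan-++-∷ xs ys (acc ++ x ∷ []) f∉

  afterLast-++-∷ : ∀ {f} xs ys → f ∉ ys → afterLast f (xs ++ f ∷ ys) ≡ ys
  afterLast-++-∷ {f} xs ys f∉ = trans (afterLast≡scan f (xs ++ f ∷ ys)) (scan-++-∷ xs ys [] f∉)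

  dropLast-∷ʳ : ∀ xs y → dropLast (xs ++ y ∷ []) ≡ xs
  dropLast-∷ʳ []            y = refl
  dropLast-∷ʳ (x ∷ [])      y = refl
  dropLast-∷ʳ (x ∷ x′ ∷ xs) y = cong (x ∷_) (dropLast-∷ʳ (x′ ∷ xs) y)

  lastL-++ : ∀ xs {y} ys → lastL (xs ++ y ∷ ys) ≡ lastL (y ∷ ys)
  lastL-++ []            ys = refl
  lastL-++ (x ∷ [])      ys = refl
  lastL-++ (x ∷ x′ ∷ xs) ys = lastL-++ (x′ ∷ xs) ys

  lastL-∈ : ∀ c cs → ∃ λ z → lastL (c ∷ cs) ≡ just z × z ∈ c ∷ cs
  lastL-∈ c []       = c , refl , here refl
  lastL-∈ c (d ∷ cs) with lastL-∈ d cs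
  ... | z , last≡z , z∈ = z , last≡z , there z∈

  minπ₂-≤ˡ : ∀ a b → minπ₂ a b ≤π a
  minπ₂-≤ˡ a b with rank b <ᵇ rank a | <ᵇ-reflects-< (rank b) (rank a)
  ... | true  | ofʸ b<a = <⇒≤ b<a
  ... | false | _       = ≤-refl

  minπ₂-≤ʳ : ∀ a b → minπ₂ a b ≤π b
  minπ₂-≤ʳ a b with rank b <ᵇ rank a | <ᵇ-reflects-< (rank b) (rank a)
  ... | true  | _       = ≤-refl
  ... | false | ofⁿ b≮a = ≮⇒≥ b≮a

  minπ₂-sel : ∀ a b → minπ₂ a b ≡ a ⊎ minπ₂ a b ≡ b
  minπ₂-sel a b with rank b <ᵇ rank a
  ... | true  = inj₂ refl
  ... | false = inj₁ refl

  maxπ₂-≡ˡ : ∀ {a b} → b <π a → maxπ₂ a b ≡ a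
  maxπ₂-≡ˡ {a} {b} b<a with rank b <ᵇ rank a | <ᵇ-reflects-< (rank b) (rank a)
  ... | true  | _       = refl
  ... | false | ofⁿ b≮a = ⊥-elim (b≮a b<a)

  maxπ₂-≡ʳ : ∀ {a b} → a <π b → maxπ₂ a b ≡ b
  maxπ₂-≡ʳ {a} {b} a<b with rank b <ᵇ rank a | <ᵇ-reflects-< (rank b) (rank a)
  ... | true  | ofʸ b<a = ⊥-elim (<-asym a<b b<a)
  ... | false | _       = refl

  minπ-≤-init : ∀ a xs → minπ a xs ≤π a
  minπ-≤-init a []       = ≤-refl
  minπ-≤-init a (x ∷ xs) = ≤-trans (minπ-≤-init (minπ₂ a x) xs) (minπ₂-≤ˡ a x)

  minπ-≤-∈ : ∀ a xs {y} → y ∈ xs → minπ a xs ≤π y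
  minπ-≤-∈ a (x ∷ xs) (here refl) = ≤-trans (minπ-≤-init (minπ₂ a x) xs) (minπ₂-≤ʳ a x)
  minπ-≤-∈ a (x ∷ xs) (there y∈)  = minπ-≤-∈ (minπ₂ a x) xs y∈

  minπ-sel : ∀ a xs → minπ a xs ≡ a ⊎ minπ a xs ∈ xs
  minπ-sel a []       = inj₁ refl
  minπ-sel a (x ∷ xs) with minπ-sel (minπ₂ a x) xs | minπ₂-sel a x
  ... | inj₂ min∈ | _        = inj₂ (there min∈)
  ... | inj₁ min≡ | inj₁ a≡ = inj₁ (trans min≡ a≡)
  ... | inj₁ min≡ | inj₂ x≡ = inj₂ (here (trans min≡ x≡))

  minLine : List (Fin n) → Letter n
  minLine qs = minBelow (lineSub qs)

  minLine-≤ℓ : ∀ qs → minLine qs ≤π ℓ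
  minLine-≤ℓ []       = ≤-refl
  minLine-≤ℓ (q ∷ qs) = ≤-trans (minπ₂-≤ˡ (minLine qs) (just q)) (minLine-≤ℓ qs)

  minLine-≤-∈ : ∀ qs {y} → y ∈ qs → minLine qs ≤π just y
  minLine-≤-∈ (q ∷ qs) (here refl) = minπ₂-≤ʳ (minLine qs) (just q)
  minLine-≤-∈ (q ∷ qs) (there y∈)  = ≤-trans (minπ₂-≤ˡ (minLine qs) (just q)) (minLine-≤-∈ qs y∈)

  minLine-sel : ∀ qs → minLine qs ≡ ℓ ⊎ ∃ λ p → minLine qs ≡ just p × p ∈ qs
  minLine-sel []       = inj₁ refl
  minLine-sel (q ∷ qs) with minπ₂-sel (minLine qs) (just q)
  ... | inj₂ min≡q = inj₂ (q , min≡q , here refl)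
  ... | inj₁ min≡ with minLine-sel qs
  ...   | inj₁ ≡ℓ            = inj₁ (trans min≡ ≡ℓ)
  ...   | inj₂ (p , ≡p , p∈) = inj₂ (p , trans min≡ ≡p , there p∈)

  betasFrom-ℓ : ∀ bd ws → betasFrom bd ℓ ws ≡ ℓ ∷ []
  betasFrom-ℓ bd []       = refl
  betasFrom-ℓ bd (w ∷ ws) = betasFrom-ℓ bd ws

  betasFrom-skip : ∀ bd {p} A {ws} → p ∉ A → betasFrom bd (just p) (A ++ ws) ≡ betasFrom bd (just p) ws
  betasFrom-skip bd     []      p∉ = refl
  betasFrom-skip bd {p} (a ∷ A) p∉
    rewrite dec-false (just a ≟L just p) (λ a≡p → p∉ (here (sym (just-injective a≡p)))) =
    betasFrom-skip bd A (λ p∈ → p∉ (there p∈))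

  betasFrom-stop : ∀ {bd} p C → bd ≤π just p → betasFrom bd (just p) (p ∷ C) ≡ just p ∷ []
  betasFrom-stop {bd} p C bd≤p rewrite dec-true (just p ≟L just p) refl
    with rank (just p) <ᵇ rank bd | <ᵇ-reflects-< (rank (just p)) (rank bd)
  ... | true  | ofʸ p<bd = ⊥-elim (<-irrefl refl (≤-<-trans bd≤p p<bd))
  ... | false | _        = refl

  betasFrom-continue : ∀ {bd} p C → just p <π bd →
                       betasFrom bd (just p) (p ∷ C) ≡ just p ∷ betasFrom bd (minπ ℓ (map just C)) C
  betasFrom-continue {bd} p C p<bd rewrite dec-true (just p ≟L just p) refl
    with rank (just p) <ᵇ rank bd | <ᵇ-reflects-< (rank (just p)) (rank bd)
  ... | true  | _        = refl
  ... | false | ofⁿ p≮bd = ⊥-elim (p≮bd p<bd)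

  spineLabels : List (Fin n) → List (Fin n) → List (Letter n)
  spineLabels []        ws = []
  spineLabels (q ∷ pre) ws = label (lineSub (q ∷ pre ++ ws)) ∷ spineLabels pre ws

  spineLabels≡map-just : ∀ {p ws} A → p ∈ ws → All (λ a → just p <π just a) A → spineLabels A ws ≡ map just A
  spineLabels≡map-just []      p∈ []          = refl
  spineLabels≡map-just (a ∷ A) p∈ (p<a ∷ p<A) =
    cong₂ _∷_ (maxπ₂-≡ʳ (≤-<-trans (minLine-≤-∈ (A ++ _) (∈-++⁺ʳ A p∈)) p<a))
              (spineLabels≡map-just A p∈ p<A)

  pathTo-lineSub-∉ : ∀ {p} qs → p ∉ qs → pathTo (just p) (lineSub qs) ≡ nothing
  pathTo-lineSub-∉     []       p∉ = refl
  pathTo-lineSub-∉ {p} (q ∷ qs) p∉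
    rewrite pathTo-lineSub-∉ qs (λ p∈ → p∉ (there p∈))
          | dec-false (just q ≟L just p) (λ q≡p → p∉ (here (sym (just-injective q≡p)))) = refl

  pathTo-lineSub-++ : ∀ pre {ws f s} → pathTo f (lineSub ws) ≡ just s →
                      pathTo f (lineSub (pre ++ ws)) ≡ just (spineLabels pre ws ++ s)
  pathTo-lineSub-++ []        path≡ = path≡
  pathTo-lineSub-++ (q ∷ pre) path≡ =
    cong (λ path → Maybe.map (label (lineSub (q ∷ pre ++ _)) ∷_) (path <∣> _)) (pathTo-lineSub-++ pre path≡)

  pathTo-ℓ-lineSub : ∀ {ws} → All (λ q → ℓ <π just q) ws → pathTo ℓ (lineSub ws) ≡ just (map just ws)
  pathTo-ℓ-lineSub []                      = refl
  pathTo-ℓ-lineSub {q ∷ qs} (ℓ<q ∷ ℓ<qs) rewrite pathTo-ℓ-lineSub ℓ<qs =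
    cong (λ x → just (x ∷ map just qs)) (maxπ₂-≡ʳ (≤-<-trans (minLine-≤ℓ qs) ℓ<q))

  decompose-just-∷ : ∀ P p bs →
                     decompose P (just p ∷ bs) ≡ dropLast (LTS (just p) (lineTree P)) ++ just p ∷ decompose P bs
  decompose-just-∷ P p []      = refl
  decompose-just-∷ P p (_ ∷ _) = refl

  module _ (rank-injective : Injective _≡_ _≡_ rank) where

    ≤π-antisym : ∀ {a b} → a ≤π b → b ≤π a → a ≡ b
    ≤π-antisym a≤b b≤a = rank-injective (≤-antisym a≤b b≤a)

    ≤π∧≢⇒<π : ∀ {a b} → a ≤π b → a ≢ b → a <π b
    ≤π∧≢⇒<π a≤b a≢b with m≤n⇒m<n∨m≡n a≤b
    ... | inj₁ a<b = a<b
    ... | inj₂ a≡b = ⊥-elim (a≢b (rank-injective a≡b))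

    minπ-ℓ-map-just≡minLine : ∀ xs qs → (∀ {y} → y ∈ xs → y ∈ qs) → (∀ {y} → y ∈ qs → y ∈ xs) →
                              minπ ℓ (map just xs) ≡ minLine qs
    minπ-ℓ-map-just≡minLine xs qs xs⊆qs qs⊆xs = ≤π-antisym minπ≤minLine minLine≤minπ
      where
      minπ≤minLine : minπ ℓ (map just xs) ≤π minLine qs
      minπ≤minLine with minLine-sel qs
      ... | inj₁ ≡ℓ            = subst (minπ ℓ (map just xs) ≤π_) (sym ≡ℓ) (minπ-≤-init ℓ (map just xs))
      ... | inj₂ (p , ≡p , p∈) =
        subst (minπ ℓ (map just xs) ≤π_) (sym ≡p) (minπ-≤-∈ ℓ (map just xs) (∈-map⁺ just (qs⊆xs p∈)))
      minLine≤minπ : minLine qs ≤π minπ ℓ (map just xs)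
      minLine≤minπ with minπ-sel ℓ (map just xs)
      ... | inj₁ ≡ℓ  = subst (minLine qs ≤π_) (sym ≡ℓ) (minLine-≤ℓ qs)
      ... | inj₂ min∈ with ∈-map⁻ just min∈
      ...   | y , y∈ , ≡y = subst (minLine qs ≤π_) (sym ≡y) (minLine-≤-∈ qs (xs⊆qs y∈))

    module Decomposition (P : List (Fin n)) (P-unique : Unique P) where

      bound : Letter n
      bound = minπ₂ (lastL P) ℓ

      -- The root path of T(P) enters the subtree lineSub ws through a node labelled with
      -- the π-minimum of ws ∪ {ℓ}; X collects the labels above that node.
      ParentLabelledMin : List (Fin n) → Set
      ParentLabelledMin ws = Σ (List (Letter n)) λ X →
        ∀ {f s} → pathTo f (lineSub ws) ≡ just s → rootPath f (lineSub P) ≡ X ++ minLine ws ∷ s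

      parent-root : ParentLabelledMin P
      parent-root = [] , cong (λ path → minLine P ∷ fromMaybe [] path)

      LTS-ℓ : ∀ {ws} → ParentLabelledMin ws → minLine ws ≡ ℓ → LTS ℓ (lineTree P) ≡ map just ws
      LTS-ℓ {ws} (X , parent) min≡ℓ = begin
          afterLast ℓ (rootPath ℓ (lineSub P))
        ≡⟨ cong (afterLast ℓ) (parent (pathTo-ℓ-lineSub ℓ<ws)) ⟩
          afterLast ℓ (X ++ minLine ws ∷ map just ws)
        ≡⟨ cong (λ m → afterLast ℓ (X ++ m ∷ map just ws)) min≡ℓ ⟩
          afterLast ℓ (X ++ ℓ ∷ map just ws)
        ≡⟨ afterLast-++-∷ X (map just ws) ℓ∉ ⟩
          map just ws ∎
        where
        ℓ<ws : All (λ q → ℓ <π just q) ws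
        ℓ<ws = All.tabulate λ q∈ → ≤π∧≢⇒<π (subst (_≤π _) min≡ℓ (minLine-≤-∈ ws q∈)) (λ ())
        ℓ∉ : ℓ ∉ map just ws
        ℓ∉ ℓ∈ with ∈-map⁻ just ℓ∈
        ... | _ , _ , ()

      module Occurrence (pre A : List (Fin n)) (p : Fin n) (C : List (Fin n))
                        (P≡ : pre ++ A ++ p ∷ C ≡ P) (min≡p : minLine (A ++ p ∷ C) ≡ just p)
                        (parent : ParentLabelledMin (A ++ p ∷ C)) where

        P≡′ : (pre ++ A) ++ p ∷ C ≡ P
        P≡′ = trans (++-assoc pre A (p ∷ C)) P≡

        ws-unique : Unique (A ++ p ∷ C)
        ws-unique = Unique-++⁻ʳ pre (subst Unique (sym P≡) P-unique)

        p∉A : p ∉ A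
        p∉A = Unique[xs++y∷ys]⇒y∉xs A ws-unique

        p∉C : p ∉ C
        p∉C = Unique[x∷xs]⇒x∉xs (Unique-++⁻ʳ A ws-unique)

        p≤ws : ∀ {y} → y ∈ A ++ p ∷ C → just p ≤π just y
        p≤ws y∈ = subst (_≤π _) min≡p (minLine-≤-∈ (A ++ p ∷ C) y∈)

        p<ℓ : just p <π ℓ
        p<ℓ = ≤π∧≢⇒<π (subst (_≤π ℓ) min≡p (minLine-≤ℓ (A ++ p ∷ C))) (λ ())

        p<C : ∀ {y} → y ∈ C → just p <π just y
        p<C y∈ = ≤π∧≢⇒<π (p≤ws (∈-++⁺ʳ A (there y∈))) (λ p≡y → p∉C (subst (_∈ C) (sym (just-injective p≡y)) y∈))

        p<A : All (λ a → just p <π just a) A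
        p<A = All.tabulate λ a∈ →
          ≤π∧≢⇒<π (p≤ws (∈-++⁺ˡ a∈)) (λ p≡a → p∉A (subst (_∈ A) (sym (just-injective p≡a)) a∈))

        p<minLine-C : just p <π minLine C
        p<minLine-C with minLine-sel C
        ... | inj₁ ≡ℓ            = subst (just p <π_) (sym ≡ℓ) p<ℓ
        ... | inj₂ (c , ≡c , c∈) = subst (just p <π_) (sym ≡c) (p<C c∈)

        label-p : label (lineSub (p ∷ C)) ≡ minLine C
        label-p = maxπ₂-≡ˡ p<minLine-C

        rootPath-via-p : ∀ {f s} → pathTo f (lineSub (p ∷ C)) ≡ just (minLine C ∷ s) →
                         rootPath f (lineSub P) ≡ proj₁ parent ++ just p ∷ map just A ++ minLine C ∷ s
        rootPath-via-p {f} {s} path≡ = begin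
            rootPath f (lineSub P)
          ≡⟨ proj₂ parent (pathTo-lineSub-++ A path≡) ⟩
            proj₁ parent ++ minLine (A ++ p ∷ C) ∷ spineLabels A (p ∷ C) ++ minLine C ∷ s
          ≡⟨ cong₂ (λ m l → proj₁ parent ++ m ∷ l ++ minLine C ∷ s) min≡p
                   (spineLabels≡map-just A (here refl) p<A) ⟩
            proj₁ parent ++ just p ∷ map just A ++ minLine C ∷ s ∎

        parent-C : ParentLabelledMin C
        parent-C = proj₁ parent ++ just p ∷ map just A , λ {f} {s} path≡ → begin
            rootPath f (lineSub P)
          ≡⟨ rootPath-via-p (trans (pathTo-lineSub-++ (p ∷ []) {C} path≡) (cong (λ m → just (m ∷ s)) label-p)) ⟩
            proj₁ parent ++ just p ∷ map just A ++ minLine C ∷ s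
          ≡⟨ sym (++-assoc (proj₁ parent) (just p ∷ map just A) (minLine C ∷ s)) ⟩
            (proj₁ parent ++ just p ∷ map just A) ++ minLine C ∷ s ∎

        dropLast-LTS-p : dropLast (LTS (just p) (lineTree P)) ≡ map just A
        dropLast-LTS-p = begin
            dropLast (afterLast (just p) (rootPath (just p) (lineSub P)))
          ≡⟨ cong (λ path → dropLast (afterLast (just p) path)) (rootPath-via-p path-p) ⟩
            dropLast (afterLast (just p) (proj₁ parent ++ just p ∷ map just A ++ minLine C ∷ []))
          ≡⟨ cong dropLast (afterLast-++-∷ (proj₁ parent) _ p∉) ⟩
            dropLast (map just A ++ minLine C ∷ [])
          ≡⟨ dropLast-∷ʳ (map just A) (minLine C) ⟩
            map just A ∎
          where
          path-p : pathTo (just p) (lineSub (p ∷ C)) ≡ just (minLine C ∷ [])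
          path-p rewrite pathTo-lineSub-∉ C p∉C | dec-true (just p ≟L just p) refl =
            cong (λ m → just (m ∷ [])) label-p
          p∉ : just p ∉ map just A ++ minLine C ∷ []
          p∉ p∈ with ∈-++⁻ (map just A) p∈
          ... | inj₁ p∈A with ∈-map⁻ just p∈A
          ...   | a , a∈ , p≡a = p∉A (subst (_∈ A) (sym (just-injective p≡a)) a∈)
          p∉ p∈ | inj₂ (here p≡) = <-irrefl (cong rank p≡) p<minLine-C

        decompose-p : ∀ bs → decompose P (just p ∷ bs) ≡ map just A ++ just p ∷ decompose P bs
        decompose-p bs = trans (decompose-just-∷ P p bs) (cong (_++ just p ∷ decompose P bs) dropLast-LTS-p)

        lastL-P : lastL P ≡ lastL (p ∷ C)
        lastL-P = trans (cong lastL (sym P≡′)) (lastL-++ (pre ++ A) C)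

      length-< : ∀ A (p : Fin n) C → length C < length (A ++ p ∷ C)
      length-< A p C = subst (length C <_) (sym (length-++ A)) (m≤n+m (suc (length C)) (length A))

      decompose-suffix : ∀ k pre ws → length ws < k → pre ++ ws ≡ P → ParentLabelledMin ws →
                         decompose P (betasFrom bound (minLine ws) ws) ≡ map just ws
      decompose-occurrence : ∀ k pre A p C → length C < k →
                             pre ++ A ++ p ∷ C ≡ P → minLine (A ++ p ∷ C) ≡ just p → ParentLabelledMin (A ++ p ∷ C) →
                             decompose P (betasFrom bound (just p) (p ∷ C)) ≡ map just A ++ just p ∷ map just C

      decompose-suffix (suc k) pre ws (s≤s |ws|≤k) P≡ parent with minLine-sel ws
      ... | inj₁ min≡ℓ = begin
          decompose P (betasFrom bound (minLine ws) ws)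
        ≡⟨ cong (λ b → decompose P (betasFrom bound b ws)) min≡ℓ ⟩
          decompose P (betasFrom bound ℓ ws)
        ≡⟨ cong (decompose P) (betasFrom-ℓ bound ws) ⟩
          LTS ℓ (lineTree P)
        ≡⟨ LTS-ℓ parent min≡ℓ ⟩
          map just ws ∎
      ... | inj₂ (p , min≡p , p∈) with ∈-∃++ p∈
      ...   | A , C , refl = begin
          decompose P (betasFrom bound (minLine (A ++ p ∷ C)) (A ++ p ∷ C))
        ≡⟨ cong (λ b → decompose P (betasFrom bound b (A ++ p ∷ C))) min≡p ⟩
          decompose P (betasFrom bound (just p) (A ++ p ∷ C))
        ≡⟨ cong (decompose P) (betasFrom-skip bound A (Occurrence.p∉A pre A p C P≡ min≡p parent)) ⟩
          decompose P (betasFrom bound (just p) (p ∷ C))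
        ≡⟨ decompose-occurrence k pre A p C (<-≤-trans (length-< A p C) |ws|≤k) P≡ min≡p parent ⟩
          map just A ++ just p ∷ map just C
        ≡⟨ sym (map-++ just A (p ∷ C)) ⟩
          map just (A ++ p ∷ C) ∎

      decompose-occurrence k pre A p [] _ P≡ min≡p parent = begin
          decompose P (betasFrom bound (just p) (p ∷ []))
        ≡⟨ cong (decompose P) (betasFrom-stop p [] bound≤p) ⟩
          decompose P (just p ∷ [])
        ≡⟨ decompose-p [] ⟩
          map just A ++ just p ∷ [] ∎
        where
        open Occurrence pre A p [] P≡ min≡p parent
        bound≤p : bound ≤π just p
        bound≤p = subst (bound ≤π_) lastL-P (minπ₂-≤ˡ (lastL P) ℓ)
      decompose-occurrence k pre A p C@(c ∷ cs) |C|<k P≡ min≡p parent = begin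
          decompose P (betasFrom bound (just p) (p ∷ C))
        ≡⟨ cong (decompose P) (betasFrom-continue p C p<bound) ⟩
          decompose P (just p ∷ betasFrom bound (minπ ℓ (map just C)) C)
        ≡⟨ cong (λ b → decompose P (just p ∷ betasFrom bound b C)) (minπ-ℓ-map-just≡minLine C C id id) ⟩
          decompose P (just p ∷ betasFrom bound (minLine C) C)
        ≡⟨ decompose-p (betasFrom bound (minLine C) C) ⟩
          map just A ++ just p ∷ decompose P (betasFrom bound (minLine C) C)
        ≡⟨ cong (λ d → map just A ++ just p ∷ d) (decompose-suffix k (pre ++ A ++ p ∷ []) C |C|<k P≡″ parent-C) ⟩
          map just A ++ just p ∷ map just C ∎
        where
        open Occurrence pre A p C P≡ min≡p parent
        P≡″ : (pre ++ A ++ p ∷ []) ++ C ≡ P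
        P≡″ = trans (++-assoc pre (A ++ p ∷ []) C) (trans (cong (pre ++_) (++-assoc A (p ∷ []) C)) P≡)
        p<bound : just p <π bound
        p<bound with minπ₂-sel (lastL P) ℓ | lastL-∈ c cs
        ... | inj₂ bound≡ℓ    | _                = subst (just p <π_) (sym bound≡ℓ) p<ℓ
        ... | inj₁ bound≡last | z , last≡z , z∈ =
          subst (just p <π_) (sym (trans bound≡last (trans lastL-P last≡z))) (p<C z∈)

    map-just≡rhs : ∀ P → P ↭ allFin n → map just P ≡ rhs P
    map-just≡rhs P P↭ = sym (begin
        decompose P (betasFrom bound π₁ P)
      ≡⟨ cong (λ b → decompose P (betasFrom bound b P)) π₁≡minLine ⟩
        decompose P (betasFrom bound (minLine P) P)
      ≡⟨ decompose-suffix (suc (length P)) [] P ≤-refl refl parent-root ⟩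
        map just P ∎)
      where
      allFin⊆P : ∀ {y} → y ∈ allFin n → y ∈ P
      allFin⊆P {y} _ = ∈-resp-↭ (↭-sym P↭) (∈-allFin y)
      P-unique : Unique P
      P-unique = PermutationSetoid.Unique-resp-↭ (setoid (Fin n)) (↭⇒↭ₛ (↭-sym P↭)) (allFin⁺ n)
      open Decomposition P P-unique
      π₁≡minLine : π₁ ≡ minLine P
      π₁≡minLine = minπ-ℓ-map-just≡minLine (allFin n) P allFin⊆P (λ {y} _ → ∈-allFin y)

proposition1 : (n : ℕ) (rank : Letter n → ℕ) → Injective _≡_ _≡_ rank →
    Order.π₁ rank ≢ ℓ →
    (k : ℕ) (P : Fin k → List (Fin n)) → (∀ i → P i ↭ allFin n) →
    ∀ i → map just (P i) ≡ Order.rhs rank (P i)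
proposition1 n rank rank-injective _ k P P↭ i = LineTree.map-just≡rhs rank rank-injective (P i) (P↭ i)
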